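{- For every EPCF program $M$ and every EPCF value $V$: $M\Downarrow^{\mathsf E}V\iff M\twoheadrightarrow_{\mathtt{wh}}V$.
   Context: EPCF terms: $L,M,N::=x\mid M\cdot N\mid\lambda x.M\mid\mathbf{fix}\,M\mid M\langle N/x\rangle\mid\mathbf 0\mid\mathbf{pred}\,M\mid\mathbf{succ}\,M\mid\mathbf{ifz}(L,M,N)$, where $x$ is bound in $M$ in the explicit substitution $M\langle N/x\rangle$; terms up to $\alpha$-conversion; $\underline n=\mathbf{succ}^n(\mathbf 0)$. For $\sigma=\langle N_1/x_1\rangle\cdots\langle N_n/x_n\rangle$ ($x_i$ pairwise distinct, $n\ge 0$), $M^\sigma=(\cdots(M\langle N_1/x_1\rangle)\cdots)\langle N_n/x_n\rangle$, $\mathrm{dom}(\sigma)=\{x_i\}$, $\sigma(x_i)=N_i$. An EPCF program is a closed EPCF term all of whose subterms of the form $M\langle N/x\rangle$ have $N$ closed. EPCF values: numerals $\underline n$ and terms $(\lambda x.M)^\sigma$. Evaluation contexts $E::=\square\mid E\cdot M\mid\mathbf{pred}\,E\mid\mathbf{succ}\,E\mid\mathbf{ifz}(E,M,N)$. Computation reduction $\to_{\mathsf{cr}}$: $E[(\lambda x.M)^\sigma N]\to E[M^\sigma\langle N/x\rangle]$, $E[\mathbf{pred}\,\mathbf 0]\to E[\mathbf 0]$, $E[\mathbf{pred}\,\underline{n+1}]\to E[\underline n]$, $E[\mathbf{ifz}(\mathbf 0,M,N)]\to E[M]$, $E[\mathbf{ifz}(\underline{n+1},M,N)]\to E[N]$,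 $E[\mathbf{fix}\,M]\to E[M(\mathbf{fix}\,M)]$. Percolation $\to_{\mathsf{pr}}$ (σ nonempty): $E[x^\sigma]\to E[N]$ if $\sigma(x)=N$; $E[y^\sigma]\to E[y]$ if $y\notin\mathrm{dom}\sigma$; $E[\mathbf 0^\sigma]\to E[\mathbf 0]$; $E[(M\cdot N)^\sigma]\to E[M^\sigma\cdot N^\sigma]$; $E[(\mathbf{pred}\,M)^\sigma]\to E[\mathbf{pred}(M^\sigma)]$; $E[(\mathbf{succ}\,M)^\sigma]\to E[\mathbf{succ}(M^\sigma)]$; $E[\mathbf{ifz}(L,M,N)^\sigma]\to E[\mathbf{ifz}(L^\sigma,M^\sigma,N^\sigma)]$; $E[(\mathbf{fix}\,M)^\sigma]\to E[\mathbf{fix}(M^\sigma)]$. $\to_{\mathtt{wh}}=\to_{\mathsf{cr}}\cup\to_{\mathsf{pr}}$; $\twoheadrightarrow_{\mathtt{wh}}$ its reflexive-transitive closure. Big-step relation $\Downarrow^{\mathsf E}$ (σ, σ' possibly empty lists) is the least relation with: $(\underline n)^\sigma\Downarrow\underline n$; $(\lambda x.M)^\sigma\Downarrow(\lambda x.M)^\sigma$; $x^\sigma\Downarrow V$ if $\sigma(x)=N$ and $N\Downarrow V$; $(\mathbf{pred}\,M)^\sigma\Downarrow\mathbf 0$ if $M^\sigma\Downarrow\mathbf 0$; $(\mathbf{pred}\,M)^\sigma\Downarrow\underline n$ if $M^\sigma\Downarrow\underline{n+1}$; $(\mathbf{succ}\,M)^\sigma\Downarrow\underline{n+1}$ if $M^\sigma\Downarrow\underline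 n$; $\mathbf{ifz}(L,M,N)^\sigma\Downarrow V_1$ if $L^\sigma\Downarrow\mathbf 0$ and $M^\sigma\Downarrow V_1$; $\mathbf{ifz}(L,M,N)^\sigma\Downarrow V_2$ if $L^\sigma\Downarrow\underline{n+1}$ and $N^\sigma\Downarrow V_2$; $(\mathbf{fix}\,M)^\sigma\Downarrow V$ if $M^\sigma\cdot\mathbf{fix}(M^\sigma)\Downarrow V$; $(M\cdot N)^\sigma\Downarrow V$ if $M^\sigma\Downarrow(\lambda x.M')^{\sigma'}$ and $M'^{\sigma'}\langle N^\sigma/x\rangle\Downarrow V$. -}

module Defs where

open import Data.Nat using (ℕ; zero; suc; _+_)
open import Data.Fin using (Fin; _↑ˡ_; _↑ʳ_)
import Data.Fin as Fin
open import Data.List using (List; []; _∷_; length; lookup)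
open import Data.Product using (Σ; ∃; _×_; _,_)
open import Data.Sum using (_⊎_)
open import Relation.Binary.PropositionalEquality using (_≡_)
open import Relation.Binary.Construct.Closure.ReflexiveTransitive using (Star)

-- In an explicit substitution  M ⟨ N ⟩  (named: M⟨N/x⟩) the variable x is
-- de Bruijn index 0 of M.  The substituted term N is required to be closed
-- (Term 0): this builds the "EPCF program" side condition (all N in
-- M⟨N/x⟩ are closed) into the syntax, so EPCF programs are exactly Term 0.
infixl 7 _·_
infixl 8 _⟨_⟩
data Term : ℕ → Set where
  var  : ∀ {n} → Fin n → Term n
  _·_  : ∀ {n} → Term n → Term n → Term n
  ƛ    : ∀ {n} → Term (suc n) → Term n
  fix  : ∀ {n} → Term n → Term n
  _⟨_⟩ : ∀ {n} → Term (suc n) → Term 0 → Term n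
  𝟎    : ∀ {n} → Term n
  pred : ∀ {n} → Term n → Term n
  succ : ∀ {n} → Term n → Term n
  ifz  : ∀ {n} → Term n → Term n → Term n → Term n

Program : Set
Program = Term 0

num : ∀ {n} → ℕ → Term n
num zero    = 𝟎
num (suc k) = succ (num k)

-- Lists of explicit substitutions σ = ⟨N₁/x₁⟩⋯⟨Nₖ/xₖ⟩, represented as the
-- list N₁ ∷ ⋯ ∷ Nₖ ∷ [] of closed terms; x₁ is index 0, …, xₖ is index k-1
-- (pairwise distinctness of the xᵢ is automatic with de Bruijn binders).
Subst : Set
Subst = List (Term 0)

sub : ∀ {n} (σ : Subst) → Term (length σ + n) → Term n
sub []      M = M
sub (N ∷ σ) M = sub σ (M ⟨ N ⟩)

infixl 6 sub
syntax sub σ M = M ^ σ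

-- Renaming (needed only to realise the α-conversion implicit in the rule
-- (λx.M)^σ N → M^σ⟨N/x⟩, where x is chosen fresh for σ).
ext : ∀ {m n} → (Fin m → Fin n) → Fin (suc m) → Fin (suc n)
ext ρ Fin.zero    = Fin.zero
ext ρ (Fin.suc i) = Fin.suc (ρ i)

rename : ∀ {m n} → (Fin m → Fin n) → Term m → Term n
rename ρ (var i)     = var (ρ i)
rename ρ (M · N)     = rename ρ M · rename ρ N
rename ρ (ƛ M)       = ƛ (rename (ext ρ) M)
rename ρ (fix M)     = fix (rename ρ M)
rename ρ (M ⟨ N ⟩)   = rename (ext ρ) M ⟨ N ⟩
rename ρ 𝟎           = 𝟎
rename ρ (pred M)    = pred (rename ρ M)
rename ρ (succ M)    = succ (rename ρ M)
rename ρ (ifz L M N) = ifz (rename ρ L) (rename ρ M) (rename ρ N)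

-- The body M of λx.M has x as index 0 and the variables x₁…xₖ of σ as
-- indices 1…k.  In M^σ⟨N/x⟩ the binders of σ are innermost and x is
-- outermost, so x must become index k (indices 1…k shift down by one,
-- indices > k fixed): this renaming does that.
swapOut : ∀ k n → Fin (suc (k + n)) → Fin (k + suc n)
swapOut zero    n i                       = i
swapOut (suc k) n Fin.zero                = Fin.suc (swapOut k n Fin.zero)
swapOut (suc k) n (Fin.suc Fin.zero)      = Fin.zero
swapOut (suc k) n (Fin.suc (Fin.suc j))   = Fin.suc (swapOut k n (Fin.suc j))

bodySub : (σ : Subst) → Term (suc (length σ + 0)) → Term 0 → Term 0
bodySub σ M N = (rename (swapOut (length σ) 0) M ^ σ) ⟨ N ⟩

data Value : Term 0 → Set where
  v-num : ∀ k → Value (num k)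
  v-lam : ∀ (σ : Subst) (M : Term (suc (length σ + 0))) → Value (ƛ M ^ σ)

data Ctx : Set where
  □     : Ctx
  _·ₑ_  : Ctx → Term 0 → Ctx
  predₑ : Ctx → Ctx
  succₑ : Ctx → Ctx
  ifzₑ  : Ctx → Term 0 → Term 0 → Ctx

plug : Ctx → Term 0 → Term 0
plug □             T = T
plug (E ·ₑ M)      T = plug E T · M
plug (predₑ E)     T = pred (plug E T)
plug (succₑ E)     T = succ (plug E T)
plug (ifzₑ E M N)  T = ifz (plug E T) M N

data _↦cr_ : Term 0 → Term 0 → Set where
  cr-β      : ∀ σ M N → ((ƛ M ^ σ) · N) ↦cr bodySub σ M N
  cr-pred0  : pred 𝟎 ↦cr 𝟎
  cr-predS  : ∀ k → pred (num (suc k)) ↦cr num k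
  cr-ifz0   : ∀ M N → ifz 𝟎 M N ↦cr M
  cr-ifzS   : ∀ k M N → ifz (num (suc k)) M N ↦cr N
  cr-fix    : ∀ M → fix M ↦cr (M · fix M)

data _↦pr_ : Term 0 → Term 0 → Set where
  pr-var  : ∀ N₀ σ (i : Fin (length (N₀ ∷ σ))) →
            (var (i ↑ˡ 0) ^ (N₀ ∷ σ)) ↦pr lookup (N₀ ∷ σ) i
  -- y ∉ dom σ (vacuous for closed terms, kept for completeness)
  pr-var' : ∀ N₀ σ (j : Fin 0) →
            (var (length (N₀ ∷ σ) ↑ʳ j) ^ (N₀ ∷ σ)) ↦pr var j
  pr-𝟎    : ∀ N₀ σ → (𝟎 ^ (N₀ ∷ σ)) ↦pr 𝟎
  pr-app  : ∀ N₀ σ M N → ((M · N) ^ (N₀ ∷ σ)) ↦pr ((M ^ (N₀ ∷ σ)) · (N ^ (N₀ ∷ σ)))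
  pr-pred : ∀ N₀ σ M → (pred M ^ (N₀ ∷ σ)) ↦pr pred (M ^ (N₀ ∷ σ))
  pr-succ : ∀ N₀ σ M → (succ M ^ (N₀ ∷ σ)) ↦pr succ (M ^ (N₀ ∷ σ))
  pr-ifz  : ∀ N₀ σ L M N →
            (ifz L M N ^ (N₀ ∷ σ)) ↦pr ifz (L ^ (N₀ ∷ σ)) (M ^ (N₀ ∷ σ)) (N ^ (N₀ ∷ σ))
  pr-fix  : ∀ N₀ σ M → (fix M ^ (N₀ ∷ σ)) ↦pr fix (M ^ (N₀ ∷ σ))

data _→wh_ : Term 0 → Term 0 → Set where
  cr : ∀ E {T U} → T ↦cr U → plug E T →wh plug E U
  pr : ∀ E {T U} → T ↦pr U → plug E T →wh plug E U

_↠wh_ : Term 0 → Term 0 → Set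
_↠wh_ = Star _→wh_

data _⇓_ : Term 0 → Term 0 → Set where
  ⇓-num  : ∀ σ k → (num k ^ σ) ⇓ num k
  ⇓-lam  : ∀ σ M → (ƛ M ^ σ) ⇓ (ƛ M ^ σ)
  ⇓-var  : ∀ σ (i : Fin (length σ)) {V} →
           lookup σ i ⇓ V → (var (i ↑ˡ 0) ^ σ) ⇓ V
  ⇓-pred0 : ∀ σ M → (M ^ σ) ⇓ 𝟎 → (pred M ^ σ) ⇓ 𝟎
  ⇓-predS : ∀ σ M k → (M ^ σ) ⇓ num (suc k) → (pred M ^ σ) ⇓ num k
  ⇓-succ  : ∀ σ M k → (M ^ σ) ⇓ num k → (succ M ^ σ) ⇓ num (suc k)
  ⇓-ifz0  : ∀ σ L M N {V₁} → (L ^ σ) ⇓ 𝟎 → (M ^ σ) ⇓ V₁ → (ifz L M N ^ σ) ⇓ V₁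
  ⇓-ifzS  : ∀ σ L M N k {V₂} → (L ^ σ) ⇓ num (suc k) → (N ^ σ) ⇓ V₂ →
            (ifz L M N ^ σ) ⇓ V₂
  ⇓-fix   : ∀ σ M {V} → ((M ^ σ) · fix (M ^ σ)) ⇓ V → (fix M ^ σ) ⇓ V
  ⇓-app   : ∀ σ M N σ' M' {V} → (M ^ σ) ⇓ (ƛ M' ^ σ') →
            bodySub σ' M' (N ^ σ) ⇓ V → ((M · N) ^ σ) ⇓ V

{-# OPTIONS --safe #-}
-- Soundness is by induction on the derivation of M ⇓ V: each rule is simulated
-- by percolating σ one step through the head constructor, running the premises
-- inside an evaluation context, and finishing with one computation step.
-- Completeness is head expansion: if T →wh U then every evaluation of U is one
-- of T.  For a redex this holds because the ⇓-rules at a nonempty σ mirror the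
-- percolation steps and those at σ = [] mirror the computation steps; the
-- property is stable under plugging into evaluation contexts, and a value
-- evaluates to itself.
module Submission where

open import Defs
open import Data.Product using (_×_; _,_)
open import Data.Nat using (zero; suc; _+_)
open import Data.Fin using (_↑ˡ_)
open import Data.List using ([]; _∷_; length)
open import Data.Unit using (⊤; tt)
open import Data.Empty using (⊥; ⊥-elim)
open import Relation.Nullary using (¬_)
open import Relation.Binary.PropositionalEquality using (_≡_; refl; cong; subst₂)
open import Relation.Binary.Construct.Closure.ReflexiveTransitive using (ε; _◅_; _◅◅_; gmap)

infixr 9 _∘ᶜ_
_∘ᶜ_ : Ctx → Ctx → Ctx
□            ∘ᶜ E′ = E′
(E ·ₑ M)     ∘ᶜ E′ = (E ∘ᶜ E′) ·ₑ M
predₑ E      ∘ᶜ E′ = predₑ (E ∘ᶜ E′)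
succₑ E      ∘ᶜ E′ = succₑ (E ∘ᶜ E′)
ifzₑ E M N   ∘ᶜ E′ = ifzₑ (E ∘ᶜ E′) M N

plug-∘ᶜ : ∀ E E′ T → plug (E ∘ᶜ E′) T ≡ plug E (plug E′ T)
plug-∘ᶜ □            E′ T = refl
plug-∘ᶜ (E ·ₑ M)     E′ T = cong (_· M) (plug-∘ᶜ E E′ T)
plug-∘ᶜ (predₑ E)    E′ T = cong pred (plug-∘ᶜ E E′ T)
plug-∘ᶜ (succₑ E)    E′ T = cong succ (plug-∘ᶜ E E′ T)
plug-∘ᶜ (ifzₑ E M N) E′ T = cong (λ L → ifz L M N) (plug-∘ᶜ E E′ T)

plug-→wh : ∀ E {T U} → T →wh U → plug E T →wh plug E U
plug-→wh E (cr E′ {T} {U} r) = subst₂ _→wh_ (plug-∘ᶜ E E′ T) (plug-∘ᶜ E E′ U) (cr (E ∘ᶜ E′) r)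
plug-→wh E (pr E′ {T} {U} r) = subst₂ _→wh_ (plug-∘ᶜ E E′ T) (plug-∘ᶜ E E′ U) (pr (E ∘ᶜ E′) r)

plug-↠wh : ∀ E {T U} → T ↠wh U → plug E T ↠wh plug E U
plug-↠wh E = gmap (plug E) (plug-→wh E)

num-^-↠wh : ∀ σ k → (num k ^ σ) ↠wh num k
num-^-↠wh []      k       = ε
num-^-↠wh (N ∷ σ) zero    = pr □ (pr-𝟎 N σ) ◅ ε
num-^-↠wh (N ∷ σ) (suc k) = pr □ (pr-succ N σ (num k)) ◅ plug-↠wh (succₑ □) (num-^-↠wh (N ∷ σ) k)

pred-^-↠wh : ∀ σ M → (pred M ^ σ) ↠wh pred (M ^ σ)
pred-^-↠wh []      M = ε
pred-^-↠wh (N ∷ σ) M = pr □ (pr-pred N σ M) ◅ ε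

succ-^-↠wh : ∀ σ M → (succ M ^ σ) ↠wh succ (M ^ σ)
succ-^-↠wh []      M = ε
succ-^-↠wh (N ∷ σ) M = pr □ (pr-succ N σ M) ◅ ε

ifz-^-↠wh : ∀ σ L M N → (ifz L M N ^ σ) ↠wh ifz (L ^ σ) (M ^ σ) (N ^ σ)
ifz-^-↠wh []       L M N = ε
ifz-^-↠wh (N′ ∷ σ) L M N = pr □ (pr-ifz N′ σ L M N) ◅ ε

fix-^-↠wh : ∀ σ M → (fix M ^ σ) ↠wh fix (M ^ σ)
fix-^-↠wh []      M = ε
fix-^-↠wh (N ∷ σ) M = pr □ (pr-fix N σ M) ◅ ε

·-^-↠wh : ∀ σ M N → ((M · N) ^ σ) ↠wh ((M ^ σ) · (N ^ σ))
·-^-↠wh []       M N = ε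
·-^-↠wh (N′ ∷ σ) M N = pr □ (pr-app N′ σ M N) ◅ ε

⇓⇒↠wh : ∀ {M V} → M ⇓ V → M ↠wh V
⇓⇒↠wh (⇓-num σ k)            = num-^-↠wh σ k
⇓⇒↠wh (⇓-lam σ M)            = ε
⇓⇒↠wh (⇓-var (N ∷ σ) i d)    = pr □ (pr-var N σ i) ◅ ⇓⇒↠wh d
⇓⇒↠wh (⇓-pred0 σ M d)        =
  pred-^-↠wh σ M ◅◅ plug-↠wh (predₑ □) (⇓⇒↠wh d) ◅◅ cr □ cr-pred0 ◅ ε
⇓⇒↠wh (⇓-predS σ M k d)      =
  pred-^-↠wh σ M ◅◅ plug-↠wh (predₑ □) (⇓⇒↠wh d) ◅◅ cr □ (cr-predS k) ◅ ε
⇓⇒↠wh (⇓-succ σ M k d)       = succ-^-↠wh σ M ◅◅ plug-↠wh (succₑ □) (⇓⇒↠wh d)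
⇓⇒↠wh (⇓-ifz0 σ L M N d e)   =
  ifz-^-↠wh σ L M N ◅◅ plug-↠wh (ifzₑ □ (M ^ σ) (N ^ σ)) (⇓⇒↠wh d)
    ◅◅ cr □ (cr-ifz0 (M ^ σ) (N ^ σ)) ◅ ⇓⇒↠wh e
⇓⇒↠wh (⇓-ifzS σ L M N k d e) =
  ifz-^-↠wh σ L M N ◅◅ plug-↠wh (ifzₑ □ (M ^ σ) (N ^ σ)) (⇓⇒↠wh d)
    ◅◅ cr □ (cr-ifzS k (M ^ σ) (N ^ σ)) ◅ ⇓⇒↠wh e
⇓⇒↠wh (⇓-fix σ M d)          = fix-^-↠wh σ M ◅◅ cr □ (cr-fix (M ^ σ)) ◅ ⇓⇒↠wh d
⇓⇒↠wh (⇓-app σ M N σ′ M′ d e) =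
  ·-^-↠wh σ M N ◅◅ plug-↠wh (□ ·ₑ (N ^ σ)) (⇓⇒↠wh d)
    ◅◅ cr □ (cr-β σ′ M′ (N ^ σ)) ◅ ⇓⇒↠wh e

IsExplicitSubst : ∀ {n} → Term n → Set
IsExplicitSubst (_ ⟨ _ ⟩) = ⊤
IsExplicitSubst _         = ⊥

^-∷-isExplicitSubst : ∀ {n} σ (M : Term (suc (length σ + n))) N →
                      IsExplicitSubst ((M ⟨ N ⟩) ^ σ)
^-∷-isExplicitSubst []       M N = tt
^-∷-isExplicitSubst (N′ ∷ σ) M N = ^-∷-isExplicitSubst σ (M ⟨ N ⟩) N′

-- The ⇓-rules instantiated at σ = [], with a nonzero numeral read as
-- succ applied to a numeral that evaluates to itself.
infix 4 _⇓ʰ_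
data _⇓ʰ_ : Term 0 → Term 0 → Set where
  𝟎ʰ     : 𝟎 ⇓ʰ 𝟎
  ƛʰ     : ∀ M → ƛ M ⇓ʰ ƛ M
  pred0ʰ : ∀ M → M ⇓ 𝟎 → pred M ⇓ʰ 𝟎
  predSʰ : ∀ M k → M ⇓ num (suc k) → pred M ⇓ʰ num k
  succʰ  : ∀ M k → M ⇓ num k → succ M ⇓ʰ num (suc k)
  ifz0ʰ  : ∀ L M N {V} → L ⇓ 𝟎 → M ⇓ V → ifz L M N ⇓ʰ V
  ifzSʰ  : ∀ L M N k {V} → L ⇓ num (suc k) → N ⇓ V → ifz L M N ⇓ʰ V
  fixʰ   : ∀ M {V} → (M · fix M) ⇓ V → fix M ⇓ʰ V
  ·ʰ     : ∀ M N σ′ M′ {V} → M ⇓ (ƛ M′ ^ σ′) → bodySub σ′ M′ N ⇓ V → (M · N) ⇓ʰ V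

-- Matching on a derivation of  pred M ⇓ V  directly is not possible, since its
-- subject  pred M ^ σ  is stuck on σ; this lemma performs that inversion once.
⇓-head : ∀ {T V} → T ⇓ V → ¬ IsExplicitSubst T → T ⇓ʰ V
⇓-head (⇓-num [] zero)             _  = 𝟎ʰ
⇓-head (⇓-num [] (suc k))          _  = succʰ (num k) k (⇓-num [] k)
⇓-head (⇓-lam [] M)                _  = ƛʰ M
⇓-head (⇓-pred0 [] M d)            _  = pred0ʰ M d
⇓-head (⇓-predS [] M k d)          _  = predSʰ M k d
⇓-head (⇓-succ [] M k d)           _  = succʰ M k d
⇓-head (⇓-ifz0 [] L M N d e)       _  = ifz0ʰ L M N d e
⇓-head (⇓-ifzS [] L M N k d e)     _  = ifzSʰ L M N k d e
⇓-head (⇓-fix [] M d)              _  = fixʰ M d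
⇓-head (⇓-app [] M N σ′ M′ d e)    _  = ·ʰ M N σ′ M′ d e
⇓-head (⇓-num (N ∷ σ) k)           ne = ⊥-elim (ne (^-∷-isExplicitSubst σ (num k) N))
⇓-head (⇓-lam (N ∷ σ) M)           ne = ⊥-elim (ne (^-∷-isExplicitSubst σ (ƛ M) N))
⇓-head (⇓-var (N ∷ σ) i d)         ne = ⊥-elim (ne (^-∷-isExplicitSubst σ (var (i ↑ˡ 0)) N))
⇓-head (⇓-pred0 (N ∷ σ) M d)       ne = ⊥-elim (ne (^-∷-isExplicitSubst σ (pred M) N))
⇓-head (⇓-predS (N ∷ σ) M k d)     ne = ⊥-elim (ne (^-∷-isExplicitSubst σ (pred M) N))
⇓-head (⇓-succ (N ∷ σ) M k d)      ne = ⊥-elim (ne (^-∷-isExplicitSubst σ (succ M) N))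
⇓-head (⇓-ifz0 (N′ ∷ σ) L M N d e) ne = ⊥-elim (ne (^-∷-isExplicitSubst σ (ifz L M N) N′))
⇓-head (⇓-ifzS (N′ ∷ σ) L M N k d e) ne = ⊥-elim (ne (^-∷-isExplicitSubst σ (ifz L M N) N′))
⇓-head (⇓-fix (N ∷ σ) M d)         ne = ⊥-elim (ne (^-∷-isExplicitSubst σ (fix M) N))
⇓-head (⇓-app (N′ ∷ σ) M N σ′ M′ d e) ne = ⊥-elim (ne (^-∷-isExplicitSubst σ (M · N) N′))

num-⇓-inv : ∀ k {V} → num k ⇓ V → V ≡ num k
num-⇓-inv zero    d with ⇓-head d (λ ())
... | 𝟎ʰ = refl
num-⇓-inv (suc k) d with ⇓-head d (λ ())
... | succʰ _ _ e = cong succ (num-⇓-inv k e)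

infix 4 _⇓⊆_
_⇓⊆_ : Term 0 → Term 0 → Set
U ⇓⊆ T = ∀ {W} → U ⇓ W → T ⇓ W

plug-mono-⇓⊆ : ∀ E {T U} → U ⇓⊆ T → plug E U ⇓⊆ plug E T
plug-mono-⇓⊆ □ U⊆T d = U⊆T d
plug-mono-⇓⊆ (E ·ₑ M) U⊆T d with ⇓-head d (λ ())
... | ·ʰ _ _ σ′ M′ a b = ⇓-app [] _ M σ′ M′ (plug-mono-⇓⊆ E U⊆T a) b
plug-mono-⇓⊆ (predₑ E) U⊆T d with ⇓-head d (λ ())
... | pred0ʰ _ a   = ⇓-pred0 [] _ (plug-mono-⇓⊆ E U⊆T a)
... | predSʰ _ k a = ⇓-predS [] _ k (plug-mono-⇓⊆ E U⊆T a)
plug-mono-⇓⊆ (succₑ E) U⊆T d with ⇓-head d (λ ())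
... | succʰ _ k a = ⇓-succ [] _ k (plug-mono-⇓⊆ E U⊆T a)
plug-mono-⇓⊆ (ifzₑ E M N) U⊆T d with ⇓-head d (λ ())
... | ifz0ʰ _ _ _ a b   = ⇓-ifz0 [] _ M N (plug-mono-⇓⊆ E U⊆T a) b
... | ifzSʰ _ _ _ k a b = ⇓-ifzS [] _ M N k (plug-mono-⇓⊆ E U⊆T a) b

↦cr-⇓⊆ : ∀ {T U} → T ↦cr U → U ⇓⊆ T
↦cr-⇓⊆ (cr-β σ M N)     d = ⇓-app [] (ƛ M ^ σ) N σ M (⇓-lam σ M) d
↦cr-⇓⊆ cr-pred0         d with num-⇓-inv 0 d
... | refl = ⇓-pred0 [] 𝟎 (⇓-num [] 0)
↦cr-⇓⊆ (cr-predS k)     d with num-⇓-inv k d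
... | refl = ⇓-predS [] (num (suc k)) k (⇓-num [] (suc k))
↦cr-⇓⊆ (cr-ifz0 M N)    d = ⇓-ifz0 [] 𝟎 M N (⇓-num [] 0) d
↦cr-⇓⊆ (cr-ifzS k M N)  d = ⇓-ifzS [] (num (suc k)) M N k (⇓-num [] (suc k)) d
↦cr-⇓⊆ (cr-fix M)       d = ⇓-fix [] M d

↦pr-⇓⊆ : ∀ {T U} → T ↦pr U → U ⇓⊆ T
↦pr-⇓⊆ (pr-var N₀ σ i) d = ⇓-var (N₀ ∷ σ) i d
↦pr-⇓⊆ (pr-𝟎 N₀ σ) d with num-⇓-inv 0 d
... | refl = ⇓-num (N₀ ∷ σ) 0
↦pr-⇓⊆ (pr-app N₀ σ M N) d with ⇓-head d (λ ())
... | ·ʰ _ _ σ′ M′ a b = ⇓-app (N₀ ∷ σ) M N σ′ M′ a b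
↦pr-⇓⊆ (pr-pred N₀ σ M) d with ⇓-head d (λ ())
... | pred0ʰ _ a   = ⇓-pred0 (N₀ ∷ σ) M a
... | predSʰ _ k a = ⇓-predS (N₀ ∷ σ) M k a
↦pr-⇓⊆ (pr-succ N₀ σ M) d with ⇓-head d (λ ())
... | succʰ _ k a = ⇓-succ (N₀ ∷ σ) M k a
↦pr-⇓⊆ (pr-ifz N₀ σ L M N) d with ⇓-head d (λ ())
... | ifz0ʰ _ _ _ a b   = ⇓-ifz0 (N₀ ∷ σ) L M N a b
... | ifzSʰ _ _ _ k a b = ⇓-ifzS (N₀ ∷ σ) L M N k a b
↦pr-⇓⊆ (pr-fix N₀ σ M) d with ⇓-head d (λ ())
... | fixʰ _ a = ⇓-fix (N₀ ∷ σ) M a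

→wh-⇓⊆ : ∀ {T U} → T →wh U → U ⇓⊆ T
→wh-⇓⊆ (cr E r) = plug-mono-⇓⊆ E (↦cr-⇓⊆ r)
→wh-⇓⊆ (pr E r) = plug-mono-⇓⊆ E (↦pr-⇓⊆ r)

value-⇓-self : ∀ {V} → Value V → V ⇓ V
value-⇓-self (v-num k)   = ⇓-num [] k
value-⇓-self (v-lam σ M) = ⇓-lam σ M

↠wh⇒⇓ : ∀ {M V} → Value V → M ↠wh V → M ⇓ V
↠wh⇒⇓ v ε        = value-⇓-self v
↠wh⇒⇓ v (s ◅ ss) = →wh-⇓⊆ s (↠wh⇒⇓ v ss)

proposition2p12 : (M V : Program) → Value V → (M ⇓ V → M ↠wh V) × (M ↠wh V → M ⇓ V)
proposition2p12 M V v = ⇓⇒↠wh , ↠wh⇒⇓ v
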